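{- Let $G$ be a complete directed graph with (non-negative) cost function $c$. Then there exists a complete metric directed graph $\hat G$ of which $G$ is a minor.
   Context: A complete directed graph with cost function $c$ is metric if $c(u,v)+c(v,w)\ge c(u,w)$ for all vertices $u,v,w$. A contraction of an edge $(u,v)$ replaces $u$ and $v$ by a single vertex $uv$ and sets $c(w,uv)=\min\{c(w,u),c(w,v)\}$ and $c(uv,w)=\min\{c(u,w),c(v,w)\}$ for all other vertices $w$. $G$ is a minor of $\hat G$ if $G$ results from $\hat G$ by a sequence of contractions (up to renaming vertices).
   Formalization: The cost function $c$ of $G$ takes non-negative rational values, and the costs of $\hat G$ are taken in the rationals as well. -}

module Defs where

open import Data.Nat using (ℕ; suc)
open import Data.Fin using (Fin; punchIn; _≟_)
open import Data.Fin.Permutation using (Permutation′; _⟨$⟩ʳ_)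
open import Data.Rational using (ℚ; 0ℚ; _≤_; _+_; _⊓_)
open import Data.Product using (Σ; _×_)
open import Relation.Binary.PropositionalEquality using (_≡_; _≢_)
open import Relation.Nullary using (yes; no)

-- Only the values on pairs of distinct vertices (the edges) are meaningful;
-- every notion below only inspects those values.
Graph : ℕ → Set
Graph n = Fin n → Fin n → ℚ

NonNegCost : ∀ {n} → Graph n → Set
NonNegCost {n} c = (u v : Fin n) → u ≢ v → 0ℚ ≤ c u v

Metric : ∀ {n} → Graph n → Set
Metric {n} c = (u v w : Fin n) → u ≢ v → v ≢ w → u ≢ w → c u w ≤ c u v + c v w

-- The result lives on Fin m: vertex x of the new graph stands for the old
-- vertex punchIn v x (i.e. v is removed), except that the vertex with
-- punchIn v x ≡ u is the merged vertex uv, which stands for both u and v.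
-- minOver x g = min of g over the old vertices represented by x.
minOver : ∀ {m} (u v : Fin (suc m)) → Fin m → (Fin (suc m) → ℚ) → ℚ
minOver u v x g with punchIn v x ≟ u
... | yes _ = g u ⊓ g v
... | no  _ = g (punchIn v x)

contract : ∀ {m} → Graph (suc m) → (u v : Fin (suc m)) → u ≢ v → Graph m
contract c u v _ x y = minOver u v x (λ a → minOver u v y (λ b → c a b))

Renaming : ∀ {n} → Graph n → Graph n → Set
Renaming {n} G H =
  Σ (Permutation′ n) λ σ → (x y : Fin n) → x ≢ y → G (σ ⟨$⟩ʳ x) (σ ⟨$⟩ʳ y) ≡ H x y

data Minor : ∀ {n m} → Graph n → Graph m → Set where
  done : ∀ {n} {G Ĝ : Graph n} → Renaming G Ĝ → Minor G Ĝ
  step : ∀ {n m} {G : Graph n} {Ĝ : Graph (suc m)} (u v : Fin (suc m)) (u≢v : u ≢ v)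
       → Minor G (contract Ĝ u v u≢v) → Minor G Ĝ

-- Blow every vertex a up into the n copies (k , a).  The only edge of the big
-- graph that is not charged a uniform upper bound M is (b , a) → (a , b), of
-- cost c a b.  These cheap edges are paired by the involution (k , a) ↦ (a , k),
-- so two of them are never consecutive on a path u → v → w with u ≢ w, which
-- gives the triangle inequality.  Contracting the copies of each vertex into one
-- takes minima over the merged edges and therefore recovers exactly c.
module Submission where

open import Defs
open import Data.Nat using (ℕ; zero; suc; _*_; _<_; _≤′_; ≤′-refl; ≤′-step)
import Data.Nat.Properties as ℕ
open import Data.Fin
  using (Fin; zero; suc; toℕ; fromℕ; fromℕ<; punchIn; punchOut; _≟_; combine; remQuot; remainder; quotient)
open import Data.Fin.Properties
  using (toℕ-fromℕ; toℕ-fromℕ<; toℕ-↑ˡ; toℕ<n; toℕ-injective; punchInᵢ≢i; punchIn-punchOut;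
         punchOut-cong; punchOut-punchIn; remQuot-combine; combine-remQuot)
import Data.Fin.Permutation as Permutation
open import Data.Rational using (ℚ; 0ℚ; _≤_; _+_; _⊔_)
open import Data.Rational.Properties
  using (≤-refl; ≤-trans; ≤-reflexive; ≤-antisym; ⊓-sel; p⊓q≤p; p⊓q≤q; p≤p⊔q; p≤q⊔p;
         +-mono-≤; +-identityˡ; +-identityʳ)
open import Data.Product using (Σ; ∃₂; _×_; _,_; proj₁; proj₂)
open import Data.Sum using (_⊎_; inj₁; inj₂)
open import Function using (_∘_)
open import Relation.Binary.PropositionalEquality
open import Relation.Nullary using (yes; no)
open import Relation.Nullary.Negation using (contradiction)

p≤q⇒p≤q+r : ∀ {p q r} → p ≤ q → 0ℚ ≤ r → p ≤ q + r
p≤q⇒p≤q+r {q = q} p≤q 0≤r =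
  ≤-trans (≤-trans p≤q (≤-reflexive (sym (+-identityʳ q)))) (+-mono-≤ (≤-refl {q}) 0≤r)

p≤r⇒p≤q+r : ∀ {p q r} → p ≤ r → 0ℚ ≤ q → p ≤ q + r
p≤r⇒p≤q+r {r = r} p≤r 0≤q =
  ≤-trans (≤-trans p≤r (≤-reflexive (sym (+-identityˡ r)))) (+-mono-≤ 0≤q (≤-refl {r}))

upperBound : ∀ {n} (f : Fin n → ℚ) → Σ ℚ λ M → 0ℚ ≤ M × (∀ i → f i ≤ M)
upperBound {zero}  f = 0ℚ , ≤-refl , λ ()
upperBound {suc n} f with upperBound (f ∘ suc)
... | M , 0≤M , f∘suc≤M = f zero ⊔ M , ≤-trans 0≤M (p≤q⊔p (f zero) M) , bound
  where
  bound : ∀ i → f i ≤ f zero ⊔ M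
  bound zero    = p≤p⊔q (f zero) M
  bound (suc i) = ≤-trans (f∘suc≤M i) (p≤q⊔p (f zero) M)

upperBound₂ : ∀ {n} (c : Graph n) → Σ ℚ λ M → 0ℚ ≤ M × (∀ a b → c a b ≤ M)
upperBound₂ c with upperBound (proj₁ ∘ upperBound ∘ c)
... | M , 0≤M , bound = M , 0≤M , λ a b → ≤-trans (proj₂ (proj₂ (upperBound (c a))) b) (bound a)

module PairingGraph {N : ℕ} (σ : Fin N → Fin N) (w : Graph N) (M : ℚ) where

  pairingGraph : Graph N
  pairingGraph p q with q ≟ σ p
  ... | yes _ = w p q
  ... | no  _ = M

  pairingGraph-paired : ∀ {p q} → q ≡ σ p → pairingGraph p q ≡ w p q
  pairingGraph-paired {p} {q} q≡σp with q ≟ σ p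
  ... | yes _    = refl
  ... | no q≢σp = contradiction q≡σp q≢σp

  pairingGraph-≤ : (∀ p q → w p q ≤ M) → ∀ p q → pairingGraph p q ≤ M
  pairingGraph-≤ w≤M p q with q ≟ σ p
  ... | yes _ = w≤M p q
  ... | no  _ = ≤-refl

  pairingGraph-≥ : ∀ {a p q} → (q ≡ σ p → a ≤ w p q) → a ≤ M → a ≤ pairingGraph p q
  pairingGraph-≥ {p = p} {q} a≤w a≤M with q ≟ σ p
  ... | yes q≡σp = a≤w q≡σp
  ... | no  _    = a≤M

  pairingGraph-nonNeg : 0ℚ ≤ M → (∀ p q → p ≢ q → q ≡ σ p → 0ℚ ≤ w p q) →
                        NonNegCost pairingGraph
  pairingGraph-nonNeg 0≤M 0≤w p q p≢q = pairingGraph-≥ (0≤w p q p≢q) 0≤M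

  pairingGraph-metric : (∀ p → σ (σ p) ≡ p) → (∀ p q → w p q ≤ M) → NonNegCost pairingGraph →
                        Metric pairingGraph
  pairingGraph-metric σ-involutive w≤M nonNeg x y z x≢y y≢z x≢z with y ≟ σ x
  ... | no _ = p≤q⇒p≤q+r (pairingGraph-≤ w≤M x z) (nonNeg y z y≢z)
  ... | yes y≡σx with z ≟ σ y
  ...   | no _ =
    p≤r⇒p≤q+r (pairingGraph-≤ w≤M x z) (subst (0ℚ ≤_) (pairingGraph-paired y≡σx) (nonNeg x y x≢y))
  ...   | yes z≡σy = contradiction (sym (trans z≡σy (trans (cong σ y≡σx) (σ-involutive x)))) x≢z

≢-preimage : ∀ {A B : Set} (f : A → B) {a b x y} → f a ≡ x → f b ≡ y → x ≢ y → a ≢ b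
≢-preimage f fa≡x fb≡y x≢y a≡b = x≢y (trans (sym fa≡x) (trans (cong f a≡b) fb≡y))

record MinQuotient {N m : ℕ} (B : Graph N) (r : Fin N → Fin m) (H : Graph m) : Set where
  field
    lower    : ∀ {x y} → x ≢ y → ∀ {p q} → r p ≡ x → r q ≡ y → H x y ≤ B p q
    attained : ∀ {x y} → x ≢ y → ∃₂ λ p q → r p ≡ x × r q ≡ y × B p q ≡ H x y

minQuotient-cancel : ∀ {N m k} {A : Graph N} {B : Graph m} {C : Graph k}
                       {r : Fin N → Fin m} {s : Fin m → Fin k} {t : Fin N → Fin k} →
                     MinQuotient A r B → MinQuotient A t C → (∀ p → t p ≡ s (r p)) →
                     MinQuotient B s C
minQuotient-cancel {A = A} {B} {C} {r} {s} {t} A→B A→C t≗s∘r =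
  record { lower = lower ; attained = attained }
  where
  module AB = MinQuotient A→B
  module AC = MinQuotient A→C

  lower : ∀ {x y} → x ≢ y → ∀ {p′ q′} → s p′ ≡ x → s q′ ≡ y → C x y ≤ B p′ q′
  lower x≢y {p′} {q′} sp′≡x sq′≡y with AB.attained (≢-preimage s sp′≡x sq′≡y x≢y)
  ... | p , q , rp≡p′ , rq≡q′ , App≡B =
    ≤-trans (AC.lower x≢y (trans (t≗s∘r p) (trans (cong s rp≡p′) sp′≡x))
                          (trans (t≗s∘r q) (trans (cong s rq≡q′) sq′≡y)))
            (≤-reflexive App≡B)

  attained : ∀ {x y} → x ≢ y → ∃₂ λ p′ q′ → s p′ ≡ x × s q′ ≡ y × B p′ q′ ≡ C x y
  attained x≢y with AC.attained x≢y
  ... | p , q , tp≡x , tq≡y , Apq≡C =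
    r p , r q , s∘r≡ p tp≡x , s∘r≡ q tq≡y ,
    ≤-antisym (≤-trans (AB.lower (≢-preimage s (s∘r≡ p tp≡x) (s∘r≡ q tq≡y) x≢y) refl refl)
                       (≤-reflexive Apq≡C))
              (lower x≢y (s∘r≡ p tp≡x) (s∘r≡ q tq≡y))
    where
    s∘r≡ : ∀ p {x} → t p ≡ x → s (r p) ≡ x
    s∘r≡ p tp≡x = trans (sym (t≗s∘r p)) tp≡x

punchOut≡⇒punchIn≡ : ∀ {n} {i j : Fin (suc n)} (i≢j : i ≢ j) {x} →
                     punchOut i≢j ≡ x → punchIn i x ≡ j
punchOut≡⇒punchIn≡ {i = i} i≢j refl = punchIn-punchOut i≢j

punchIn≡⇒punchOut≡ : ∀ {n} {i j : Fin (suc n)} (i≢j : i ≢ j) {x} →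
                     punchIn i x ≡ j → punchOut i≢j ≡ x
punchIn≡⇒punchOut≡ {i = i} i≢j refl = trans (punchOut-cong i refl) (punchOut-punchIn i)

module Merge {k : ℕ} {u v : Fin (suc k)} (u≢v : u ≢ v) where

  v≢u : v ≢ u
  v≢u = u≢v ∘ sym

  merge : Fin (suc k) → Fin k
  merge z with z ≟ v
  ... | yes _   = punchOut v≢u
  ... | no  z≢v = punchOut (z≢v ∘ sym)

  merge-fibre : ∀ z {x} → merge z ≡ x → (z ≡ v × punchIn v x ≡ u) ⊎ punchIn v x ≡ z
  merge-fibre z mz≡x with z ≟ v
  ... | yes z≡v = inj₁ (z≡v , punchOut≡⇒punchIn≡ v≢u mz≡x)
  ... | no  z≢v = inj₂ (punchOut≡⇒punchIn≡ (z≢v ∘ sym) mz≡x)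

  merge-u : merge u ≡ punchOut v≢u
  merge-u with u ≟ v
  ... | yes _ = refl
  ... | no  _ = punchOut-cong v refl

  merge-v : merge v ≡ punchOut v≢u
  merge-v with v ≟ v
  ... | yes _   = refl
  ... | no  v≢v = contradiction refl v≢v

  merge-punchIn : ∀ x → merge (punchIn v x) ≡ x
  merge-punchIn x with punchIn v x ≟ v
  ... | yes pᵥx≡v = contradiction pᵥx≡v (punchInᵢ≢i v x)
  ... | no  pᵥx≢v = punchIn≡⇒punchOut≡ (pᵥx≢v ∘ sym) refl

  respects-punchIn∘merge : ∀ {A : Set} (f : Fin (suc k) → A) → f u ≡ f v →
                           ∀ z → f z ≡ f (punchIn v (merge z))
  respects-punchIn∘merge f fu≡fv z with merge-fibre z refl
  ... | inj₁ (z≡v , pᵥmz≡u) = trans (cong f z≡v) (trans (sym fu≡fv) (cong f (sym pᵥmz≡u)))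
  ... | inj₂ pᵥmz≡z         = cong f (sym pᵥmz≡z)

  minOver-≤ : ∀ x (g : Fin (suc k) → ℚ) {z} → merge z ≡ x → minOver u v x g ≤ g z
  minOver-≤ x g {z} mz≡x with punchIn v x ≟ u | merge-fibre z mz≡x
  ... | yes _    | inj₁ (refl , _) = p⊓q≤q (g u) (g v)
  ... | yes pᵥx≡u | inj₂ pᵥx≡z     =
    ≤-trans (p⊓q≤p (g u) (g v)) (≤-reflexive (cong g (trans (sym pᵥx≡u) pᵥx≡z)))
  ... | no pᵥx≢u  | inj₁ (_ , pᵥx≡u) = contradiction pᵥx≡u pᵥx≢u
  ... | no _     | inj₂ refl        = ≤-refl

  minOver-attained : ∀ x (g : Fin (suc k) → ℚ) →
                     Σ (Fin (suc k)) λ z → merge z ≡ x × g z ≡ minOver u v x g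
  minOver-attained x g with punchIn v x ≟ u
  ... | no _ = punchIn v x , merge-punchIn x , refl
  ... | yes pᵥx≡u with ⊓-sel (g u) (g v)
  ...   | inj₁ min≡gu = u , trans merge-u (punchIn≡⇒punchOut≡ v≢u pᵥx≡u) , sym min≡gu
  ...   | inj₂ min≡gv = v , trans merge-v (punchIn≡⇒punchOut≡ v≢u pᵥx≡u) , sym min≡gv

contract-minQuotient : ∀ {k} (B : Graph (suc k)) {u v : Fin (suc k)} (u≢v : u ≢ v) →
                       MinQuotient B (Merge.merge u≢v) (contract B u v u≢v)
contract-minQuotient B {u} {v} u≢v = record { lower = lower ; attained = attained }
  where
  open Merge u≢v

  lower : ∀ {x y} → x ≢ y → ∀ {p q} → merge p ≡ x → merge q ≡ y →
          contract B u v u≢v x y ≤ B p q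
  lower {x} {y} _ {p} mp≡x mq≡y =
    ≤-trans (minOver-≤ x (λ a → minOver u v y (B a)) mp≡x) (minOver-≤ y (B p) mq≡y)

  attained : ∀ {x y} → x ≢ y →
             ∃₂ λ p q → merge p ≡ x × merge q ≡ y × B p q ≡ contract B u v u≢v x y
  attained {x} {y} _ with minOver-attained x (λ a → minOver u v y (B a))
  ... | p , mp≡x , min₁≡ with minOver-attained y (B p)
  ...   | q , mq≡y , min₂≡ = p , q , mp≡x , mq≡y , trans min₂≡ min₁≡

IdentityOnPrefix : ∀ {N n} → (Fin N → Fin n) → Set
IdentityOnPrefix {N} {n} f = ∀ (z : Fin N) (i : Fin n) → toℕ z ≡ toℕ i → f z ≡ i

toℕ-punchIn-fromℕ : ∀ k (y : Fin k) → toℕ (punchIn (fromℕ k) y) ≡ toℕ y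
toℕ-punchIn-fromℕ (suc k) zero    = refl
toℕ-punchIn-fromℕ (suc k) (suc y) = cong suc (toℕ-punchIn-fromℕ k y)

-- Contract the last vertex into the prefix vertex representing its class, until
-- only the prefix Fin n is left.
minQuotient⇒minor : ∀ {n N} {G : Graph n} {B : Graph N} {f : Fin N → Fin n} →
                    n ≤′ N → IdentityOnPrefix f → MinQuotient B f G → Minor G B
minQuotient⇒minor {G = G} {B} {f} ≤′-refl f-id B→G = done (Permutation.id , G≡B)
  where
  G≡B : ∀ x y → x ≢ y → G x y ≡ B x y
  G≡B x y x≢y with MinQuotient.attained B→G x≢y
  ... | p , q , fp≡x , fq≡y , Bpq≡G =
    sym (trans (cong₂ B (trans (sym fp≡x) (f-id p p refl)) (trans (sym fq≡y) (f-id q q refl))) Bpq≡G)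
minQuotient⇒minor {n} {suc k} {G} {B} {f} (≤′-step n≤′k) f-id B→G =
  step u v u≢v (minQuotient⇒minor n≤′k f∘punchIn-id B′→G)
  where
  v : Fin (suc k)
  v = fromℕ k

  fv<k : toℕ (f v) < k
  fv<k = ℕ.<-≤-trans (toℕ<n (f v)) (ℕ.≤′⇒≤ n≤′k)

  u : Fin (suc k)
  u = fromℕ< (ℕ.m≤n⇒m≤1+n fv<k)

  u≢v : u ≢ v
  u≢v u≡v = ℕ.<-irrefl (trans (sym (toℕ-fromℕ< _)) (trans (cong toℕ u≡v) (toℕ-fromℕ k))) fv<k

  fu≡fv : f u ≡ f v
  fu≡fv = f-id u (f v) (toℕ-fromℕ< _)

  f∘punchIn-id : IdentityOnPrefix (f ∘ punchIn v)
  f∘punchIn-id y i y≡i = f-id (punchIn v y) i (trans (toℕ-punchIn-fromℕ k y) y≡i)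

  B′→G : MinQuotient (contract B u v u≢v) (f ∘ punchIn v) G
  B′→G = minQuotient-cancel (contract-minQuotient B u≢v) B→G
                            (Merge.respects-punchIn∘merge u≢v f fu≡fv)

remainder-identityOnPrefix : ∀ {m n} → IdentityOnPrefix (remainder {m} n)
remainder-identityOnPrefix {suc m} {n} z i z≡i =
  trans (cong (remainder n) (toℕ-injective (trans z≡i (sym (toℕ-↑ˡ i (m * n))))))
        (cong proj₂ (remQuot-combine {suc m} zero i))

module SquareFactors (n : ℕ) where

  vertex tag : Fin (n * n) → Fin n
  vertex = remainder {n} n
  tag    = quotient {n} n

  swapFactors : Fin (n * n) → Fin (n * n)
  swapFactors p = combine (vertex p) (tag p)

  remQuot-swapFactors : ∀ p → remQuot {n} n (swapFactors p) ≡ (vertex p , tag p)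
  remQuot-swapFactors p = remQuot-combine {n} {n} (vertex p) (tag p)

  vertex-swapFactors : ∀ p → vertex (swapFactors p) ≡ tag p
  vertex-swapFactors p = cong proj₂ (remQuot-swapFactors p)

  swapFactors-involutive : ∀ p → swapFactors (swapFactors p) ≡ p
  swapFactors-involutive p =
    trans (cong₂ combine (vertex-swapFactors p) (cong proj₁ (remQuot-swapFactors p))) (combine-remQuot {n} n p)

  swapFactors-fixed : ∀ p → vertex p ≡ tag p → swapFactors p ≡ p
  swapFactors-fixed p v≡t = trans (cong₂ combine v≡t (sym v≡t)) (combine-remQuot {n} n p)

  vertex-combine : ∀ k a → vertex (combine k a) ≡ a
  vertex-combine k a = cong proj₂ (remQuot-combine {n} {n} k a)

  swapFactors-combine : ∀ k a → swapFactors (combine k a) ≡ combine a k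
  swapFactors-combine k a = cong₂ combine (vertex-combine k a) (cong proj₁ (remQuot-combine {n} {n} k a))

  swapFactors-separates : ∀ p → p ≢ swapFactors p → vertex p ≢ vertex (swapFactors p)
  swapFactors-separates p p≢σp vp≡vσp =
    p≢σp (sym (swapFactors-fixed p (trans vp≡vσp (vertex-swapFactors p))))

n≤′n*n : ∀ n → n ≤′ n * n
n≤′n*n zero    = ≤′-refl
n≤′n*n (suc n) = ℕ.≤⇒≤′ (ℕ.m≤m*n (suc n) (suc n))

module BlowUp {n : ℕ} (c : Graph n) where
  open SquareFactors n

  M : ℚ
  M = proj₁ (upperBound₂ c)

  0≤M : 0ℚ ≤ M
  0≤M = proj₁ (proj₂ (upperBound₂ c))

  c≤M : ∀ a b → c a b ≤ M
  c≤M = proj₂ (proj₂ (upperBound₂ c))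

  open PairingGraph swapFactors (λ p q → c (vertex p) (vertex q)) M

  blowUp : Graph (n * n)
  blowUp = pairingGraph

  blowUp-nonNeg : NonNegCost c → NonNegCost blowUp
  blowUp-nonNeg c≥0 = pairingGraph-nonNeg 0≤M λ { p _ p≢σp refl → c≥0 _ _ (swapFactors-separates p p≢σp) }

  blowUp-metric : NonNegCost c → Metric blowUp
  blowUp-metric c≥0 = pairingGraph-metric swapFactors-involutive (λ p q → c≤M _ _) (blowUp-nonNeg c≥0)

  blowUp-minQuotient : MinQuotient blowUp vertex c
  blowUp-minQuotient = record { lower = lower ; attained = attained }
    where
    lower : ∀ {x y} → x ≢ y → ∀ {p q} → vertex p ≡ x → vertex q ≡ y → c x y ≤ blowUp p q
    lower {x} {y} _ vp≡x vq≡y =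
      pairingGraph-≥ (λ _ → ≤-reflexive (sym (cong₂ c vp≡x vq≡y))) (c≤M x y)

    attained : ∀ {x y} → x ≢ y → ∃₂ λ p q → vertex p ≡ x × vertex q ≡ y × blowUp p q ≡ c x y
    attained {x} {y} _ =
      combine y x , combine x y , vertex-combine y x , vertex-combine x y ,
      trans (pairingGraph-paired (sym (swapFactors-combine y x)))
            (cong₂ c (vertex-combine y x) (vertex-combine x y))

proposition4p3 : (n : ℕ) (G : Graph n) → NonNegCost G →
    Σ ℕ λ m → Σ (Graph m) λ Ĝ → NonNegCost Ĝ × Metric Ĝ × Minor G Ĝ
proposition4p3 n G G≥0 =
  n * n , blowUp , blowUp-nonNeg G≥0 , blowUp-metric G≥0 ,
  minQuotient⇒minor (n≤′n*n n) (remainder-identityOnPrefix {n}) blowUp-minQuotient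
  where open BlowUp G
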